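{- Let $a,b,i\in\mathbb{Z}$ with $a<b$ and $a\leq i\leq b$, and let $c=\delta_{[a+1,b-1]}+\delta_i$. Then the stabilization of $c$ is $\widetilde{c}=\delta_{[a,a+b-i-1]}+\delta_{[a+b-i+1,b]}$.
   Context: Unlabeled chip-firing on $\mathbb{Z}$: a configuration is a function $c\colon\mathbb{Z}\to\mathbb{N}$ with finite total sum ($c(i)$ chips at vertex $i$); if $c(i)\geq 2$ one may fire at $i$, moving one chip from $i$ to $i-1$ and one from $i$ to $i+1$. $c$ is stable if $c(i)\leq1$ for all $i$. Every configuration $c$ has a unique stable configuration $\widetilde{c}$ reachable from $c$ by firings (its stabilization). Sums of configurations are pointwise. $\delta_i$ is one chip at $i$; for $i,j\in\mathbb{Z}$, $\delta_{[i,j]}$ has one chip at each $k$ with $i\leq k\leq j$ and no other chips (the zero configuration if $i>j$). -}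

module Defs where

open import Data.Nat using (ℕ; _≤_; _∸_) renaming (_+_ to _+ℕ_)
open import Data.Integer using (ℤ; _+_; _-_; 1ℤ) renaming (_≤_ to _≤ℤ_)
import Data.Integer as ℤ
open import Data.Bool using (Bool; true; false; if_then_else_; _∧_; _∨_)
open import Data.Product using (Σ; _×_; _,_)
open import Relation.Nullary.Decidable using (⌊_⌋)
open import Relation.Binary.PropositionalEquality using (_≡_)

-- A chip configuration on ℤ: number of chips at each vertex.
-- (All configurations arising here have finite support; finiteness is
-- preserved by firing, so it is not needed as a separate field.)
Config : Set
Config = ℤ → ℕ

_⊕_ : Config → Config → Config
(c ⊕ d) k = c k +ℕ d k

δ : ℤ → Config
δ i k = if ⌊ k ℤ.≟ i ⌋ then 1 else 0

-- δ[ i , j ] : one chip at each k with i ≤ k ≤ j (zero config if i > j)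
δ[_,_] : ℤ → ℤ → Config
δ[ i , j ] k = if ⌊ i ℤ.≤? k ⌋ ∧ ⌊ k ℤ.≤? j ⌋ then 1 else 0

-- result of firing vertex i of c (meaningful when c i ≥ 2)
fire : Config → ℤ → Config
fire c i k =
  if ⌊ k ℤ.≟ i ⌋ then c k ∸ 2
  else if ⌊ k ℤ.≟ i - 1ℤ ⌋ ∨ ⌊ k ℤ.≟ i + 1ℤ ⌋ then c k +ℕ 1
  else c k

_⟶_ : Config → Config → Set
c ⟶ d = Σ ℤ λ i → (2 ≤ c i) × (∀ k → d k ≡ fire c i k)

data _⟶*_ : Config → Config → Set where
  done : ∀ {c d} → (∀ k → c k ≡ d k) → c ⟶* d
  step : ∀ {c e d} → c ⟶ e → e ⟶* d → c ⟶* d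

Stable : Config → Set
Stable c = ∀ k → c k ≤ 1

IsStabilization : Config → Config → Set
IsStabilization c d = (c ⟶* d) × Stable d

module Submission where

-- Induction on b − a, with hole h = a + b − i. If i = a or i = b the configuration
-- already is the stable one. Otherwise fire the doubled vertex i. The chip sent to
-- i − 1 leaves δ[a+1,i−1] + δ(i−1), an instance on [a,i] with hole a + 1, which
-- stabilizes to δ a + δ[a+2,i]; together with the chips right of i this is
-- δ a + δ[a+2,b−1] + δ(i+1), whose second part is an instance on [a+1,b] with the
-- same hole h. Firing is additive, so both stabilizations can be carried out inside
-- the larger configuration.

open import Defs
open import Data.Integer using (ℤ; _+_; _-_; _<_; _≤_; 1ℤ; +_; ∣_∣)
import Data.Integer as ℤ
import Data.Integer.Properties as ℤP
open import Data.Integer.Tactic.RingSolver using (solve)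
open import Data.Nat using (zero; suc; z≤n) renaming (_+_ to _+ℕ_; _≤_ to _≤ℕ_)
import Data.Nat.Properties as ℕP
open import Data.Bool using (true; false; _∨_)
open import Data.List using (_∷_; [])
open import Data.Product using (_,_)
open import Data.Empty using (⊥-elim)
open import Function using (_∘_)
open import Level using (0ℓ)
open import Relation.Nullary using (yes; no)
open import Relation.Nullary.Decidable using (⌊_⌋)
open import Relation.Binary.PropositionalEquality
open import Relation.Binary.Definitions using (tri<; tri≈; tri>)
open import Relation.Binary.Structures using (IsPreorder)
open import Algebra.Bundles using (CommutativeMonoid)
import Algebra.Construct.Pointwise as Pointwise
import Algebra.Properties.CommutativeSemigroup as CommutativeSemigroupProperties
import Relation.Binary.Reasoning.Base.Double as DoubleReasoning
open import Relation.Binary.Reasoning.Syntax using (module ⟶*-syntax)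

private
  variable
    a b h i j k m x x′ y y′ : ℤ
    c c′ d e : Config

i<i+1 : ∀ i → i < i + 1ℤ
i<i+1 i = ℤP.suc[i]≤j⇒i<j (ℤP.≤-reflexive (ℤP.+-comm 1ℤ i))

i-1<i : ∀ i → i - 1ℤ < i
i-1<i i = ℤP.i≤pred[j]⇒i<j (ℤP.≤-reflexive (ℤP.+-comm i ℤ.-1ℤ))

i<j⇒i+1≤j : i < j → i + 1ℤ ≤ j
i<j⇒i+1≤j {i} i<j = subst (_≤ _) (ℤP.+-comm 1ℤ i) (ℤP.i<j⇒suc[i]≤j i<j)

i<j⇒i≤j-1 : i < j → i ≤ j - 1ℤ
i<j⇒i≤j-1 {j = j} i<j = subst (_ ≤_) (ℤP.+-comm ℤ.-1ℤ j) (ℤP.i<j⇒i≤pred[j] i<j)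

i<j⇒k<k+j-i : i < j → k < k + j - i
i<j⇒k<k+j-i {i} {j} {k} i<j = begin-strict
  k            ≡⟨ solve (k ∷ i ∷ []) ⟩
  i + (k - i)  <⟨ ℤP.+-monoˡ-< (k - i) i<j ⟩
  j + (k - i)  ≡⟨ solve (k ∷ j ∷ i ∷ []) ⟩
  k + j - i    ∎
  where open ℤP.≤-Reasoning

⊕-commutativeMonoid : CommutativeMonoid 0ℓ 0ℓ
⊕-commutativeMonoid = record
  { Carrier             = Config
  ; _≈_                 = _≗_
  ; _∙_                 = _⊕_
  ; ε                   = λ _ → 0
  ; isCommutativeMonoid = Pointwise.isCommutativeMonoid ℤ ℕP.+-0-isCommutativeMonoid
  }

module ⊕ = CommutativeMonoid ⊕-commutativeMonoid

open CommutativeSemigroupProperties ⊕.commutativeSemigroup using (interchange)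
open CommutativeSemigroupProperties ℕP.+-commutativeSemigroup using ()
  renaming (xy∙z≈xz∙y to +-rightComm)

δ-self : ∀ x → δ x x ≡ 1
δ-self x with x ℤ.≟ x
... | yes _   = refl
... | no x≢x = ⊥-elim (x≢x refl)

δ-other : k ≢ x → δ x k ≡ 0
δ-other {k} {x} k≢x with k ℤ.≟ x
... | yes k≡x = ⊥-elim (k≢x k≡x)
... | no _    = refl

δ[]-before : k < x → δ[ x , y ] k ≡ 0
δ[]-before {k} {x} k<x with x ℤ.≤? k
... | yes x≤k = ⊥-elim (ℤP.<⇒≱ k<x x≤k)
... | no _    = refl

δ[]-after : y < k → δ[ x , y ] k ≡ 0
δ[]-after {y} {k} {x} y<k with x ℤ.≤? k | k ℤ.≤? y
... | yes _ | yes k≤y = ⊥-elim (ℤP.<⇒≱ y<k k≤y)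
... | yes _ | no _    = refl
... | no _  | _       = refl

δ[]-inside : x ≤ k → k ≤ y → δ[ x , y ] k ≡ 1
δ[]-inside {x} {k} {y} x≤k k≤y with x ℤ.≤? k | k ℤ.≤? y
... | yes _  | yes _  = refl
... | no x≰k | _      = ⊥-elim (x≰k x≤k)
... | yes _  | no k≰y = ⊥-elim (k≰y k≤y)

δ[]-≤1 : ∀ x y k → δ[ x , y ] k ≤ℕ 1
δ[]-≤1 x y k with x ℤ.≤? k | k ℤ.≤? y
... | yes _ | yes _ = ℕP.≤-refl
... | yes _ | no _  = z≤n
... | no _  | _     = z≤n

δ[]-lower-irrelevant : x ≤ k → x′ ≤ k → δ[ x , y ] k ≡ δ[ x′ , y ] k
δ[]-lower-irrelevant {x} {k} {x′} x≤k x′≤k with x ℤ.≤? k | x′ ℤ.≤? k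
... | yes _  | yes _   = refl
... | no x≰k | _       = ⊥-elim (x≰k x≤k)
... | yes _  | no x′≰k = ⊥-elim (x′≰k x′≤k)

δ[]-upper-irrelevant : k ≤ y → k ≤ y′ → δ[ x , y ] k ≡ δ[ x , y′ ] k
δ[]-upper-irrelevant {k} {y} {y′} k≤y k≤y′ with k ℤ.≤? y | k ℤ.≤? y′
... | yes _  | yes _   = refl
... | no k≰y | _       = ⊥-elim (k≰y k≤y)
... | yes _  | no k≰y′ = ⊥-elim (k≰y′ k≤y′)

δ[]-empty : y < x → δ[ x , y ] ≗ ⊕.ε
δ[]-empty {y} {x} y<x k with k ℤ.<? x
... | yes k<x = δ[]-before k<x
... | no k≮x  = δ[]-after (ℤP.<-≤-trans y<x (ℤP.≮⇒≥ k≮x))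

δ[]-concat : x ≤ m + 1ℤ → m ≤ y → δ[ x , y ] ≗ δ[ x , m ] ⊕ δ[ m + 1ℤ , y ]
δ[]-concat {x} {m} {y} x≤m+1 m≤y k with m ℤ.<? k
... | no m≮k = begin
  δ[ x , y ] k                       ≡⟨ δ[]-upper-irrelevant (ℤP.≤-trans k≤m m≤y) k≤m ⟩
  δ[ x , m ] k                       ≡⟨ ℕP.+-identityʳ _ ⟨
  δ[ x , m ] k +ℕ 0                  ≡⟨ cong (δ[ x , m ] k +ℕ_) (δ[]-before k<m+1) ⟨
  δ[ x , m ] k +ℕ δ[ m + 1ℤ , y ] k  ∎
  where
  open ≡-Reasoning
  k≤m : k ≤ m
  k≤m = ℤP.≮⇒≥ m≮k
  k<m+1 : k < m + 1ℤ
  k<m+1 = ℤP.≤-<-trans k≤m (i<i+1 m)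
... | yes m<k = begin
  δ[ x , y ] k                       ≡⟨ δ[]-lower-irrelevant (ℤP.≤-trans x≤m+1 m+1≤k) m+1≤k ⟩
  δ[ m + 1ℤ , y ] k                  ≡⟨ cong (_+ℕ δ[ m + 1ℤ , y ] k) (δ[]-after m<k) ⟨
  δ[ x , m ] k +ℕ δ[ m + 1ℤ , y ] k  ∎
  where
  open ≡-Reasoning
  m+1≤k : m + 1ℤ ≤ k
  m+1≤k = i<j⇒i+1≤j m<k

δ[]-extract : x ≤ m → m ≤ y → δ[ x , y ] ≗ (δ[ x , m - 1ℤ ] ⊕ δ[ m + 1ℤ , y ]) ⊕ δ m
δ[]-extract {x} {m} {y} x≤m m≤y k with ℤP.<-cmp k m
... | tri< k<m k≢m _ = begin
  δ[ x , y ] k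
    ≡⟨ δ[]-upper-irrelevant (ℤP.≤-trans (ℤP.<⇒≤ k<m) m≤y) (i<j⇒i≤j-1 k<m) ⟩
  δ[ x , m - 1ℤ ] k
    ≡⟨ trans (ℕP.+-identityʳ _) (ℕP.+-identityʳ _) ⟨
  δ[ x , m - 1ℤ ] k +ℕ 0 +ℕ 0
    ≡⟨ cong₂ (λ r s → δ[ x , m - 1ℤ ] k +ℕ r +ℕ s)
             (δ[]-before (ℤP.<-trans k<m (i<i+1 m))) (δ-other k≢m) ⟨
  δ[ x , m - 1ℤ ] k +ℕ δ[ m + 1ℤ , y ] k +ℕ δ m k
    ∎
  where open ≡-Reasoning
... | tri≈ _ refl _ = begin
  δ[ x , y ] m
    ≡⟨ δ[]-inside x≤m m≤y ⟩
  0 +ℕ 0 +ℕ 1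
    ≡⟨ cong₂ (λ r s → r +ℕ s +ℕ 1) (δ[]-after (i-1<i m)) (δ[]-before (i<i+1 m)) ⟨
  δ[ x , m - 1ℤ ] m +ℕ δ[ m + 1ℤ , y ] m +ℕ 1
    ≡⟨ cong (δ[ x , m - 1ℤ ] m +ℕ δ[ m + 1ℤ , y ] m +ℕ_) (δ-self m) ⟨
  δ[ x , m - 1ℤ ] m +ℕ δ[ m + 1ℤ , y ] m +ℕ δ m m
    ∎
  where open ≡-Reasoning
... | tri> _ k≢m m<k = begin
  δ[ x , y ] k
    ≡⟨ δ[]-lower-irrelevant (ℤP.≤-trans x≤m (ℤP.<⇒≤ m<k)) (i<j⇒i+1≤j m<k) ⟩
  δ[ m + 1ℤ , y ] k
    ≡⟨ ℕP.+-identityʳ _ ⟨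
  0 +ℕ δ[ m + 1ℤ , y ] k +ℕ 0
    ≡⟨ cong₂ (λ r s → r +ℕ δ[ m + 1ℤ , y ] k +ℕ s)
             (δ[]-after (ℤP.<-trans (i-1<i m) m<k)) (δ-other k≢m) ⟨
  δ[ x , m - 1ℤ ] k +ℕ δ[ m + 1ℤ , y ] k +ℕ δ m k
    ∎
  where open ≡-Reasoning

withExtraChip : ℤ → ℤ → ℤ → Config
withExtraChip a b i = δ[ a + 1ℤ , b - 1ℤ ] ⊕ δ i

punctured : ℤ → ℤ → ℤ → Config
punctured a h b = δ[ a , h - 1ℤ ] ⊕ δ[ h + 1ℤ , b ]

punctured-stable : ∀ x h y → Stable (punctured x h y)
punctured-stable x h y k with h ℤ.<? k
... | yes h<k = begin
  δ[ x , h - 1ℤ ] k +ℕ δ[ h + 1ℤ , y ] k  ≡⟨ cong (_+ℕ δ[ h + 1ℤ , y ] k) (δ[]-after h-1<k) ⟩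
  δ[ h + 1ℤ , y ] k                        ≤⟨ δ[]-≤1 (h + 1ℤ) y k ⟩
  1                                        ∎
  where
  open ℕP.≤-Reasoning
  h-1<k : h - 1ℤ < k
  h-1<k = ℤP.<-trans (i-1<i h) h<k
... | no h≮k = begin
  δ[ x , h - 1ℤ ] k +ℕ δ[ h + 1ℤ , y ] k  ≡⟨ cong (δ[ x , h - 1ℤ ] k +ℕ_) (δ[]-before k<h+1) ⟩
  δ[ x , h - 1ℤ ] k +ℕ 0                   ≡⟨ ℕP.+-identityʳ _ ⟩
  δ[ x , h - 1ℤ ] k                        ≤⟨ δ[]-≤1 x (h - 1ℤ) k ⟩
  1                                        ∎
  where
  open ℕP.≤-Reasoning
  k<h+1 : k < h + 1ℤ
  k<h+1 = ℤP.≤-<-trans (ℤP.≮⇒≥ h≮k) (i<i+1 h)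

-- fire c i k depends on c only through c k.
fire-cong : c ≗ c′ → ∀ i → fire c i ≗ fire c′ i
fire-cong c≗c′ i k = cong (λ n → fire (λ _ → n) i k) (c≗c′ k)

⟶*-respˡ-≗ : c ≗ c′ → c ⟶* d → c′ ⟶* d
⟶*-respˡ-≗ c≗c′ (done c≗d) = done (λ k → trans (sym (c≗c′ k)) (c≗d k))
⟶*-respˡ-≗ c≗c′ (step (i , 2≤cᵢ , e≗fire) e⟶*d) =
  step (i , subst (2 ≤ℕ_) (c≗c′ i) 2≤cᵢ , λ k → trans (e≗fire k) (fire-cong c≗c′ i k))
       e⟶*d

⟶*-trans : c ⟶* d → d ⟶* e → c ⟶* e
⟶*-trans (done c≗d)         d⟶*e = ⟶*-respˡ-≗ (λ k → sym (c≗d k)) d⟶*e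
⟶*-trans (step c⟶c′ c′⟶*d) d⟶*e = step c⟶c′ (⟶*-trans c′⟶*d d⟶*e)

⟶*-isPreorder : IsPreorder _≗_ _⟶*_
⟶*-isPreorder = record
  { isEquivalence = ⊕.isEquivalence
  ; reflexive     = done
  ; trans         = ⟶*-trans
  }

module ⟶*-Reasoning where
  open DoubleReasoning ⟶*-isPreorder public
  open ⟶*-syntax _IsRelatedTo_ _IsRelatedTo_ ≲-go public

⟶⇒⟶* : c ⟶ d → c ⟶* d
⟶⇒⟶* c⟶d = step c⟶d (done (λ _ → refl))

fire-⊕ : ∀ e i k → 2 ≤ℕ c i → fire c i k +ℕ e k ≡ fire (c ⊕ e) i k
fire-⊕ {c} e i k 2≤cᵢ with k ℤ.≟ i
... | yes refl = sym (ℕP.+-∸-comm (e k) 2≤cᵢ)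
... | no _ with ⌊ k ℤ.≟ i - 1ℤ ⌋ ∨ ⌊ k ℤ.≟ i + 1ℤ ⌋
...   | true  = +-rightComm (c k) 1 (e k)
...   | false = refl

⟶-⊕ʳ : c ⟶ d → (c ⊕ e) ⟶ (d ⊕ e)
⟶-⊕ʳ {c} {e = e} (i , 2≤cᵢ , d≗fire) =
  i , ℕP.≤-trans 2≤cᵢ (ℕP.m≤m+n (c i) (e i)) ,
  λ k → trans (cong (_+ℕ e k) (d≗fire k)) (fire-⊕ e i k 2≤cᵢ)

⟶*-⊕ʳ : ∀ e → c ⟶* d → (c ⊕ e) ⟶* (d ⊕ e)
⟶*-⊕ʳ e (done c≗d)         = done (⊕.∙-congʳ c≗d)
⟶*-⊕ʳ e (step c⟶c′ c′⟶*d) = step (⟶-⊕ʳ c⟶c′) (⟶*-⊕ʳ e c′⟶*d)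

⟶*-⊕ˡ : ∀ e → c ⟶* d → (e ⊕ c) ⟶* (e ⊕ d)
⟶*-⊕ˡ {c} {d} e c⟶*d = begin
  e ⊕ c  ≈⟨ ⊕.comm e c ⟩
  c ⊕ e  ⟶*⟨ ⟶*-⊕ʳ e c⟶*d ⟩
  d ⊕ e  ≈⟨ ⊕.comm d e ⟩
  e ⊕ d  ∎
  where open ⟶*-Reasoning

fire-pair : ∀ i → (δ i ⊕ δ i) ⟶ (δ (i - 1ℤ) ⊕ δ (i + 1ℤ))
fire-pair i = i , subst (λ n → 2 ≤ℕ n +ℕ n) (sym (δ-self i)) ℕP.≤-refl , fired
  where
  fired : ∀ k → δ (i - 1ℤ) k +ℕ δ (i + 1ℤ) k ≡ fire (δ i ⊕ δ i) i k
  fired k with k ℤ.≟ i | k ℤ.≟ i - 1ℤ | k ℤ.≟ i + 1ℤ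
  ... | yes k≡i | yes k≡i-1 | _         = ⊥-elim (ℤP.<⇒≢ (i-1<i i) (trans (sym k≡i-1) k≡i))
  ... | yes k≡i | no _      | yes k≡i+1 = ⊥-elim (ℤP.<⇒≢ (i<i+1 i) (trans (sym k≡i) k≡i+1))
  ... | no _    | yes k≡i-1 | yes k≡i+1 =
    ⊥-elim (ℤP.<⇒≢ (ℤP.<-trans (i-1<i i) (i<i+1 i)) (trans (sym k≡i-1) k≡i+1))
  ... | yes _   | no _      | no _      = refl
  ... | no _    | yes _     | no _      = refl
  ... | no _    | no _      | _         = refl

withExtraChip-left-end : a < b → h ≡ b → withExtraChip a b a ≗ punctured a h b
withExtraChip-left-end {a} {b} a<b refl = begin-equality
  δ[ a + 1ℤ , b - 1ℤ ] ⊕ δ a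
    ≈⟨ ⊕.∙-congʳ (⊕.∙-congʳ (δ[]-empty (i-1<i a))) ⟨
  (δ[ a , a - 1ℤ ] ⊕ δ[ a + 1ℤ , b - 1ℤ ]) ⊕ δ a
    ≈⟨ δ[]-extract ℤP.≤-refl (i<j⇒i≤j-1 a<b) ⟨
  δ[ a , b - 1ℤ ]
    ≈⟨ ⊕.identityʳ δ[ a , b - 1ℤ ] ⟨
  δ[ a , b - 1ℤ ] ⊕ ⊕.ε
    ≈⟨ ⊕.∙-congˡ {δ[ a , b - 1ℤ ]} (δ[]-empty (i<i+1 b)) ⟨
  δ[ a , b - 1ℤ ] ⊕ δ[ b + 1ℤ , b ]
    ∎
  where open ⟶*-Reasoning

withExtraChip-right-end : a < b → h ≡ a → withExtraChip a b b ≗ punctured a h b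
withExtraChip-right-end {a} {b} a<b refl = begin-equality
  δ[ a + 1ℤ , b - 1ℤ ] ⊕ δ b
    ≈⟨ ⊕.∙-congʳ (⊕.identityʳ δ[ a + 1ℤ , b - 1ℤ ]) ⟨
  (δ[ a + 1ℤ , b - 1ℤ ] ⊕ ⊕.ε) ⊕ δ b
    ≈⟨ ⊕.∙-congʳ (⊕.∙-congˡ {δ[ a + 1ℤ , b - 1ℤ ]} (δ[]-empty (i<i+1 b))) ⟨
  (δ[ a + 1ℤ , b - 1ℤ ] ⊕ δ[ b + 1ℤ , b ]) ⊕ δ b
    ≈⟨ δ[]-extract (i<j⇒i+1≤j a<b) ℤP.≤-refl ⟨
  δ[ a + 1ℤ , b ]
    ≈⟨ ⊕.∙-congʳ (δ[]-empty (i-1<i a)) ⟨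
  δ[ a , a - 1ℤ ] ⊕ δ[ a + 1ℤ , b ]
    ∎
  where open ⟶*-Reasoning

fire-splits : a < i → i < b →
              withExtraChip a b i ⟶* (withExtraChip a i (i - 1ℤ) ⊕ withExtraChip i b (i + 1ℤ))
fire-splits {a} {i} {b} a<i i<b = begin
  L+R ⊕ δ i                            ≈⟨ ⊕.∙-congʳ (δ[]-extract (i<j⇒i+1≤j a<i) (i<j⇒i≤j-1 i<b)) ⟩
  ((L ⊕ R) ⊕ δ i) ⊕ δ i                ≈⟨ ⊕.assoc (L ⊕ R) (δ i) (δ i) ⟩
  (L ⊕ R) ⊕ (δ i ⊕ δ i)                ⟶*⟨ ⟶*-⊕ˡ (L ⊕ R) (⟶⇒⟶* (fire-pair i)) ⟩
  (L ⊕ R) ⊕ (δ (i - 1ℤ) ⊕ δ (i + 1ℤ))  ≈⟨ interchange L R (δ (i - 1ℤ)) (δ (i + 1ℤ)) ⟩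
  (L ⊕ δ (i - 1ℤ)) ⊕ (R ⊕ δ (i + 1ℤ))  ∎
  where
  open ⟶*-Reasoning
  L+R L R : Config
  L+R = δ[ a + 1ℤ , b - 1ℤ ]
  L   = δ[ a + 1ℤ , i - 1ℤ ]
  R   = δ[ i + 1ℤ , b - 1ℤ ]

punctured-⊕-withExtraChip : a < m → m < b →
  (punctured a (a + 1ℤ) m ⊕ withExtraChip m b j) ≗ (δ[ a , a ] ⊕ withExtraChip (a + 1ℤ) b j)
punctured-⊕-withExtraChip {a} {m} {b} {j} a<m m<b = begin-equality
  (A ⊕ L) ⊕ (R ⊕ δ j)       ≈⟨ ⊕.assoc A L (R ⊕ δ j) ⟩
  A ⊕ (L ⊕ (R ⊕ δ j))       ≈⟨ ⊕.∙-congˡ {A} (⊕.assoc L R (δ j)) ⟨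
  A ⊕ ((L ⊕ R) ⊕ δ j)       ≈⟨ ⊕.∙-congˡ {A} (⊕.∙-congʳ (δ[]-concat a+2≤m+1 (i<j⇒i≤j-1 m<b))) ⟨
  A ⊕ (L+R ⊕ δ j)           ≡⟨ cong (λ n → δ[ a , n ] ⊕ (L+R ⊕ δ j)) (solve (a ∷ [])) ⟩
  δ[ a , a ] ⊕ (L+R ⊕ δ j)  ∎
  where
  open ⟶*-Reasoning
  A L+R L R : Config
  A   = δ[ a , a + 1ℤ - 1ℤ ]
  L+R = δ[ a + 1ℤ + 1ℤ , b - 1ℤ ]
  L   = δ[ a + 1ℤ + 1ℤ , m ]
  R   = δ[ m + 1ℤ , b - 1ℤ ]
  a+2≤m+1 : a + 1ℤ + 1ℤ ≤ m + 1ℤ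
  a+2≤m+1 = ℤP.+-monoˡ-≤ 1ℤ (i<j⇒i+1≤j a<m)

δ[]-⊕-punctured : a < h → (δ[ a , a ] ⊕ punctured (a + 1ℤ) h b) ≗ punctured a h b
δ[]-⊕-punctured {a} {h} {b} a<h = begin-equality
  δ[ a , a ] ⊕ (δ[ a + 1ℤ , h - 1ℤ ] ⊕ δ[ h + 1ℤ , b ])
    ≈⟨ ⊕.assoc δ[ a , a ] δ[ a + 1ℤ , h - 1ℤ ] δ[ h + 1ℤ , b ] ⟨
  (δ[ a , a ] ⊕ δ[ a + 1ℤ , h - 1ℤ ]) ⊕ δ[ h + 1ℤ , b ]
    ≈⟨ ⊕.∙-congʳ (δ[]-concat (ℤP.<⇒≤ (i<i+1 a)) (i<j⇒i≤j-1 a<h)) ⟨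
  δ[ a , h - 1ℤ ] ⊕ δ[ h + 1ℤ , b ]
    ∎
  where open ⟶*-Reasoning

withExtraChip⟶*punctured-bounded :
  ∀ {a b i h} n → b ≤ a + + n → a < b → a ≤ i → i ≤ b → h ≡ a + b - i →
  withExtraChip a b i ⟶* punctured a h b
withExtraChip⟶*punctured-bounded {a} {b} zero b≤a a<b _ _ _ =
  ⊥-elim (ℤP.<⇒≱ a<b (subst (b ≤_) (ℤP.+-identityʳ a) b≤a))
withExtraChip⟶*punctured-bounded {a} {b} {i} {h} (suc n) b≤a+n+1 a<b a≤i i≤b h≡a+b-i
  with i ℤ.≟ a | i ℤ.≟ b
... | yes refl | _        = done (withExtraChip-left-end a<b (trans h≡a+b-i (solve (i ∷ b ∷ []))))
... | no _     | yes refl = done (withExtraChip-right-end a<b (trans h≡a+b-i (solve (a ∷ i ∷ []))))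
... | no i≢a   | no i≢b   = begin
  withExtraChip a b i                                      ⟶*⟨ fire-splits a<i i<b ⟩
  withExtraChip a i (i - 1ℤ) ⊕ withExtraChip i b (i + 1ℤ)  ⟶*⟨ ⟶*-⊕ʳ (withExtraChip i b (i + 1ℤ)) left ⟩
  punctured a (a + 1ℤ) i ⊕ withExtraChip i b (i + 1ℤ)      ≈⟨ punctured-⊕-withExtraChip a<i i<b ⟩
  δ[ a , a ] ⊕ withExtraChip (a + 1ℤ) b (i + 1ℤ)           ⟶*⟨ ⟶*-⊕ˡ δ[ a , a ] right ⟩
  δ[ a , a ] ⊕ punctured (a + 1ℤ) h b                      ≈⟨ δ[]-⊕-punctured a<h ⟩
  punctured a h b                                          ∎
  where
  open ⟶*-Reasoning
  a<i : a < i
  a<i = ℤP.≤∧≢⇒< a≤i (i≢a ∘ sym)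
  i<b : i < b
  i<b = ℤP.≤∧≢⇒< i≤b i≢b
  a<h : a < h
  a<h = subst (a <_) (sym h≡a+b-i) (i<j⇒k<k+j-i i<b)
  i≤a+n : i ≤ a + + n
  i≤a+n = subst (i ≤_) (sym (ℤP.+-pred a (+ suc n))) (ℤP.i<j⇒i≤pred[j] (ℤP.<-≤-trans i<b b≤a+n+1))
  left : withExtraChip a i (i - 1ℤ) ⟶* punctured a (a + 1ℤ) i
  left = withExtraChip⟶*punctured-bounded {a} {i} {i - 1ℤ} {a + 1ℤ} n i≤a+n
    a<i (i<j⇒i≤j-1 a<i) (ℤP.<⇒≤ (i-1<i i)) (solve (a ∷ i ∷ []))
  right : withExtraChip (a + 1ℤ) b (i + 1ℤ) ⟶* punctured (a + 1ℤ) h b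
  right = withExtraChip⟶*punctured-bounded {a + 1ℤ} {b} {i + 1ℤ} {h} n
    (subst (b ≤_) (sym (ℤP.+-assoc a 1ℤ (+ n))) b≤a+n+1)
    (ℤP.≤-<-trans (i<j⇒i+1≤j a<i) i<b) (ℤP.+-monoˡ-≤ 1ℤ a≤i) (i<j⇒i+1≤j i<b)
    (trans h≡a+b-i (solve (a ∷ b ∷ i ∷ [])))

withExtraChip⟶*punctured :
  a < b → a ≤ i → i ≤ b → h ≡ a + b - i → withExtraChip a b i ⟶* punctured a h b
withExtraChip⟶*punctured {a} {b} a<b =
  withExtraChip⟶*punctured-bounded ∣ b - a ∣ (ℤP.≤-reflexive b≡a+∣b-a∣) a<b
  where
  b≡a+∣b-a∣ : b ≡ a + + ∣ b - a ∣
  b≡a+∣b-a∣ = begin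
    b                ≡⟨ solve (a ∷ b ∷ []) ⟩
    a + (b - a)      ≡⟨ cong (_+_ a) (ℤP.0≤i⇒+∣i∣≡i (ℤP.i≤j⇒0≤j-i (ℤP.<⇒≤ a<b))) ⟨
    a + + ∣ b - a ∣  ∎
    where open ≡-Reasoning

proposition2p3 : (a b i : ℤ) → a < b → a ≤ i → i ≤ b →
    IsStabilization (δ[ a + 1ℤ , b - 1ℤ ] ⊕ δ i)
                    (δ[ a , a + b - i - 1ℤ ] ⊕ δ[ a + b - i + 1ℤ , b ])
proposition2p3 a b i a<b a≤i i≤b =
  withExtraChip⟶*punctured a<b a≤i i≤b refl , punctured-stable a (a + b - i) b
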